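{- For every $n\ge 1$, $\iota(\mathrm{Mid}(K_n))=\lfloor \frac{n}{2}\rfloor$, and for all $n_1,n_2\ge 1$, $\iota(\mathrm{Mid}(K_{n_1,n_2}))=\min\{n_1,n_2\}$.
   Context: For a graph $H$ and $S\subseteq V(H)$, let $N_H[S]$ be $S$ together with all vertices adjacent to a vertex of $S$. A set $S\subseteq V(H)$ is an isolating set of $H$ if $V(H)\setminus N_H[S]$ is an independent set of $H$; $\iota(H)$ is the minimum size of an isolating set of $H$. The middle graph $\mathrm{Mid}(G)$ has vertex set $V(G)\cup\{m_e: e\in E(G)\}$, with $v\sim m_e$ iff $v$ is an endpoint of $e$, $m_e\sim m_f$ iff distinct edges $e,f$ share an endpoint, and no edges between vertices of $V(G)$. -}

module Defs where

open import Data.Nat using (ℕ; _≤_; _⊓_; _/_; _+_; _<?_)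
open import Data.Fin using (Fin; _<_; _≟_; toℕ)
open import Data.Bool using (Bool; true; false; T; not; _∧_; _∨_; _xor_)
open import Data.Product using (Σ; ∃; _×_; _,_; proj₁; proj₂)
open import Data.Sum using (_⊎_; inj₁; inj₂)
open import Data.Empty using (⊥)
open import Data.List using (List; length)
open import Data.List.Membership.Propositional using (_∈_)
open import Data.List.Relation.Unary.Unique.Propositional using (Unique)
open import Relation.Nullary using (¬_)
open import Relation.Nullary.Decidable using (⌊_⌋)
open import Relation.Binary.PropositionalEquality using (_≡_)

record Graph : Set₁ where
  field
    V   : Set
    Adj : V → V → Set
open Graph public

InClosedNbhd : (H : Graph) → List (V H) → V H → Set
InClosedNbhd H S v = v ∈ S ⊎ Σ (V H) (λ s → s ∈ S × Adj H s v)

IsIsolating : (H : Graph) → List (V H) → Set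
IsIsolating H S = ∀ u v → ¬ InClosedNbhd H S u → ¬ InClosedNbhd H S v → ¬ Adj H u v

IsolationNumber : Graph → ℕ → Set
IsolationNumber H k =
  Σ (List (V H)) (λ S → Unique S × IsIsolating H S × length S ≡ k)
  × (∀ S → Unique S → IsIsolating H S → k ≤ length S)

-- A finite simple graph on vertex set Fin n, given by a Boolean adjacency
-- matrix (only used below for the symmetric, irreflexive K_n and K_{n1,n2}).
SimpleGraph : ℕ → Set
SimpleGraph n = Fin n → Fin n → Bool

-- Edges of G: unordered pairs {i,j}, represented uniquely by i < j.
Edge : ∀ {n} → SimpleGraph n → Set
Edge {n} G = Σ (Fin n) λ i → Σ (Fin n) λ j → i < j × T (G i j)

Incident : ∀ {n} (G : SimpleGraph n) → Fin n → Edge G → Set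
Incident G v (i , j , _) = v ≡ i ⊎ v ≡ j

ShareEnd : ∀ {n} (G : SimpleGraph n) → Edge G → Edge G → Set
ShareEnd G e f = ¬ (e ≡ f) × Σ _ (λ v → Incident G v e × Incident G v f)

MidAdj : ∀ {n} (G : SimpleGraph n) → Fin n ⊎ Edge G → Fin n ⊎ Edge G → Set
MidAdj G (inj₁ u) (inj₁ v) = ⊥
MidAdj G (inj₁ u) (inj₂ e) = Incident G u e
MidAdj G (inj₂ e) (inj₁ v) = Incident G v e
MidAdj G (inj₂ e) (inj₂ f) = ShareEnd G e f

Mid : ∀ {n} → SimpleGraph n → Graph
Mid {n} G = record { V = Fin n ⊎ Edge G ; Adj = MidAdj G }

K : (n : ℕ) → SimpleGraph n
K n i j = not ⌊ i ≟ j ⌋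

-- complete bipartite graph K_{n1,n2} on Fin (n1 + n2): parts {0..n1-1} and the rest
Kbip : (n₁ n₂ : ℕ) → SimpleGraph (n₁ + n₂)
Kbip n₁ n₂ i j = ⌊ toℕ i <? n₁ ⌋ xor ⌊ toℕ j <? n₁ ⌋

-- Say that a vertex of Mid(G) touches w ∈ V(G) if it is w or m_e with w ∈ e. Then w lies
-- outside N[S] iff nothing in S touches w, and m_e lies outside N[S] iff nothing in S
-- touches an endpoint of e; as V(G) is independent in Mid(G), S is isolating iff every edge
-- has a touched endpoint. Each element of S touches at most two vertices of G, and at most
-- one on each side of K_{n₁,n₂}. So fewer than ⌊n/2⌋ elements leave two vertices of K_n
-- untouched, and fewer than min(n₁,n₂) leave one untouched on each side of K_{n₁,n₂}: in
-- both cases an edge with no touched endpoint. Conversely ⌊n/2⌋ disjoint edges of K_n, or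
-- the smaller side of K_{n₁,n₂}, touch an endpoint of every edge.
module Submission where

open import Defs
open import Data.Nat as ℕ using (ℕ; _≥_; _/_; _⊓_; _+_; _*_; _%_; _<?_)
open import Data.Nat.Properties
  using (≤-trans; <-trans; <-≤-trans; n≤1+n; ≮⇒≥; <⇒≱; m≤m+n; +-monoˡ-≤; *-monoˡ-≤;
         *-comm; +-identityʳ; ≤-total; m≤n⇒m⊓n≡m; m≥n⇒m⊓n≡n; m⊓n≤m; m⊓n≤n; module ≤-Reasoning)
open import Data.Nat.DivMod using (m≡m%n+[m/n]*n; m%n<n; m/n*n≤m)
open import Data.Fin as Fin using (Fin; toℕ; fromℕ<; inject≤; combine; remQuot; _↑ˡ_; _↑ʳ_)
open import Data.Fin.Properties
  using (toℕ-injective; toℕ-fromℕ<; toℕ-inject≤; inject≤-injective; combine-injective;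
         combine-remQuot; toℕ-↑ˡ; toℕ-↑ʳ; ↑ˡ-injective; ↑ʳ-injective; splitAt-<; splitAt-≥;
         splitAt⁻¹-↑ˡ; splitAt⁻¹-↑ʳ; toℕ<n; <-cmp; <⇒≢; <-irrelevant; pigeonhole; ¬∀⟶∃¬)
open import Data.Bool using (T)
open import Data.Bool.Properties using (T-irrelevant)
open import Data.Product using (∃; ∃₂; _×_; _,_; proj₁; proj₂)
open import Data.Sum using (_⊎_; inj₁; inj₂; swap)
open import Data.Sum.Properties using (inj₁-injective; inj₂-injective)
open import Data.Empty using (⊥)
open import Data.Unit using (tt)
open import Data.List using (List; _∷_; length; map; _++_; tabulate; lookup)
open import Data.List.Properties using (length-map; length-++; length-tabulate)
open import Data.List.Relation.Unary.Any using (index; here; there)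
open import Data.List.Relation.Unary.Any.Properties using (lookup-index)
open import Data.List.Membership.Propositional using (_∈_; _∉_)
open import Data.List.Membership.Propositional.Properties using (∈-map⁺; ∈-++⁺ˡ; ∈-++⁺ʳ; ∈-tabulate⁺)
import Data.List.Relation.Unary.Unique.Propositional.Properties as Unique
import Data.List.Membership.DecPropositional as DecMembership
open import Relation.Nullary using (¬_; yes; no; contradiction)
open import Relation.Nullary.Decidable using (map′; _×-dec_)
open import Relation.Binary.Definitions using (DecidableEquality; tri<; tri≈; tri>)
open import Relation.Binary.PropositionalEquality using (_≡_; _≢_; refl; sym; trans; cong; cong₂; subst; module ≡-Reasoning)
open import Function using (_∘_; id)
open import Function.Definitions using (Injective)

pigeonhole-∉ : ∀ {a} {A : Set a} → DecidableEquality A → ∀ {m} (f : Fin m → A) → Injective _≡_ _≡_ f →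
               (xs : List A) → length xs ℕ.< m → ∃ λ i → f i ∉ xs
pigeonhole-∉ _≟_ f f-inj xs short = ¬∀⟶∃¬ _ (λ i → f i ∈ xs) (λ i → f i ∈? xs) not-all
  where
  open DecMembership _≟_ using (_∈?_)
  open ≡-Reasoning
  not-all : ¬ (∀ i → f i ∈ xs)
  not-all all-in with i , j , i<j , same-index ← pigeonhole short (index ∘ all-in) =
    <⇒≢ i<j (f-inj (begin
      f i                          ≡⟨ lookup-index (all-in i) ⟩
      lookup xs (index (all-in i)) ≡⟨ cong (lookup xs) same-index ⟩
      lookup xs (index (all-in j)) ≡⟨ lookup-index (all-in j) ⟨
      f j                          ∎))

module MiddleGraph {n : ℕ} (G : SimpleGraph n) where

  _≟ᴱ_ : DecidableEquality (Edge G)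
  e ≟ᴱ f = map′ (Edge-≡ e f) (λ e≡f → cong proj₁ e≡f , cong (proj₁ ∘ proj₂) e≡f)
                (proj₁ e Fin.≟ proj₁ f ×-dec proj₁ (proj₂ e) Fin.≟ proj₁ (proj₂ f))
    where
    Edge-≡ : ∀ e f → proj₁ e ≡ proj₁ f × proj₁ (proj₂ e) ≡ proj₁ (proj₂ f) → e ≡ f
    Edge-≡ (i , j , i<j , t) (.i , .j , i<j′ , t′) (refl , refl) =
      cong₂ (λ p q → i , j , p , q) (<-irrelevant i<j i<j′) (T-irrelevant t t′)

  end₁ end₂ : Fin n ⊎ Edge G → Fin n
  end₁ (inj₁ v)       = v
  end₁ (inj₂ (i , _)) = i
  end₂ (inj₁ v)           = v
  end₂ (inj₂ (_ , j , _)) = j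

  Touches : Fin n ⊎ Edge G → Fin n → Set
  Touches s w = w ≡ end₁ s ⊎ w ≡ end₂ s

  Touched : List (Fin n ⊎ Edge G) → Fin n → Set
  Touched S w = ∃ λ s → s ∈ S × Touches s w

  EndTouched : List (Fin n ⊎ Edge G) → Edge G → Set
  EndTouched S e = ∃ λ w → Incident G w e × Touched S w

  ends : List (Fin n ⊎ Edge G) → List (Fin n)
  ends S = map end₁ S ++ map end₂ S

  length-ends : ∀ S → length (ends S) ≡ length S + length S
  length-ends S = trans (length-++ (map end₁ S)) (cong₂ _+_ (length-map end₁ S) (length-map end₂ S))

  Touched⇒∈-ends : ∀ {S w} → Touched S w → w ∈ ends S
  Touched⇒∈-ends (s , s∈S , inj₁ refl) = ∈-++⁺ˡ (∈-map⁺ end₁ s∈S)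
  Touched⇒∈-ends (s , s∈S , inj₂ refl) = ∈-++⁺ʳ _ (∈-map⁺ end₂ s∈S)

  module _ (S : List (Fin n ⊎ Edge G)) where

    vertex-dominated⇒Touched : ∀ {v} → InClosedNbhd (Mid G) S (inj₁ v) → Touched S v
    vertex-dominated⇒Touched (inj₁ v∈S)                  = inj₁ _ , v∈S , inj₁ refl
    vertex-dominated⇒Touched (inj₂ (inj₂ f , f∈S , v∈f)) = inj₂ f , f∈S , v∈f

    edge-dominated⇒EndTouched : ∀ {e} → InClosedNbhd (Mid G) S (inj₂ e) → EndTouched S e
    edge-dominated⇒EndTouched (inj₁ e∈S)                                = _ , inj₁ refl , inj₂ _ , e∈S , inj₁ refl
    edge-dominated⇒EndTouched (inj₂ (inj₁ v , v∈S , v∈e))               = v , v∈e , inj₁ v , v∈S , inj₁ refl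
    edge-dominated⇒EndTouched (inj₂ (inj₂ f , f∈S , _ , w , w∈f , w∈e)) = w , w∈e , inj₂ f , f∈S , w∈f

    EndTouched⇒edge-dominated : ∀ {e} → EndTouched S e → InClosedNbhd (Mid G) S (inj₂ e)
    EndTouched⇒edge-dominated (_ , w∈e , inj₁ v , v∈S , inj₁ refl) = inj₂ (inj₁ v , v∈S , w∈e)
    EndTouched⇒edge-dominated (_ , w∈e , inj₁ v , v∈S , inj₂ refl) = inj₂ (inj₁ v , v∈S , w∈e)
    EndTouched⇒edge-dominated {e} (w , w∈e , inj₂ f , f∈S , w∈f) with f ≟ᴱ e
    ... | yes refl = inj₁ f∈S
    ... | no f≢e   = inj₂ (inj₂ f , f∈S , f≢e , w , w∈f , w∈e)

    EndTouched⇒isolating : (∀ e → EndTouched S e) → IsIsolating (Mid G) S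
    EndTouched⇒isolating touched (inj₁ _) (inj₁ _) _     _     ()
    EndTouched⇒isolating touched (inj₁ _) (inj₂ e) _     e-out _ = e-out (EndTouched⇒edge-dominated (touched e))
    EndTouched⇒isolating touched (inj₂ e) _        e-out _     _ = e-out (EndTouched⇒edge-dominated (touched e))

    untouched-edge⇒¬isolating : (e : Edge G) → (∀ w → Incident G w e → ¬ Touched S w) → ¬ IsIsolating (Mid G) S
    untouched-edge⇒¬isolating e untouched isolating =
      isolating (inj₁ (proj₁ e)) (inj₂ e)
        (untouched _ (inj₁ refl) ∘ vertex-dominated⇒Touched)
        (λ dominated → let w , w∈e , touched = edge-dominated⇒EndTouched dominated in untouched w w∈e touched)
        (inj₁ refl)

  vertex-cover⇒isolating : (C : List (Fin n)) → (∀ e → ∃ λ w → Incident G w e × w ∈ C) →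
                           IsIsolating (Mid G) (map inj₁ C)
  vertex-cover⇒isolating C cover = EndTouched⇒isolating (map inj₁ C) λ e →
    let w , w∈e , w∈C = cover e in w , w∈e , inj₁ w , ∈-map⁺ inj₁ w∈C , inj₁ refl

open MiddleGraph

module Complete (n : ℕ) where

  K-adj : ∀ {i j} → i ≢ j → T (K n i j)
  K-adj {i} {j} i≢j with i Fin.≟ j
  ... | yes i≡j = contradiction i≡j i≢j
  ... | no _    = tt

  K-edge : (x y : Fin n) → x ≢ y → Edge (K n)
  K-edge x y x≢y with <-cmp x y
  ... | tri< x<y _ _ = x , y , x<y , K-adj x≢y
  ... | tri≈ _ x≡y _ = contradiction x≡y x≢y
  ... | tri> _ _ y<x = y , x , y<x , K-adj (x≢y ∘ sym)

  K-edge-incident⁺ : ∀ {w} x y (x≢y : x ≢ y) → w ≡ x ⊎ w ≡ y → Incident (K n) w (K-edge x y x≢y)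
  K-edge-incident⁺ x y x≢y w∈xy with <-cmp x y
  ... | tri< _ _ _   = w∈xy
  ... | tri≈ _ x≡y _ = contradiction x≡y x≢y
  ... | tri> _ _ _   = swap w∈xy

  K-edge-incident⁻ : ∀ {w} x y (x≢y : x ≢ y) → Incident (K n) w (K-edge x y x≢y) → w ≡ x ⊎ w ≡ y
  K-edge-incident⁻ x y x≢y w∈e with <-cmp x y
  ... | tri< _ _ _   = w∈e
  ... | tri≈ _ x≡y _ = contradiction x≡y x≢y
  ... | tri> _ _ _   = swap w∈e

  K-lower : (S : List (Fin n ⊎ Edge (K n))) → IsIsolating (Mid (K n)) S → n / 2 ℕ.≤ length S
  K-lower S isolating = ≮⇒≥ short⇒¬isolating
    where
    L : List (Fin n)
    L = ends (K n) S

    room : length S ℕ.< n / 2 → 2 + length L ℕ.≤ n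
    room short = begin
      2 + length L                ≡⟨ cong (2 +_) (length-ends (K n) S) ⟩
      2 + (length S + length S)   ≡⟨ cong (λ m → 2 + (length S + m)) (+-identityʳ (length S)) ⟨
      2 + 2 * length S            ≡⟨ cong (2 +_) (*-comm 2 (length S)) ⟩
      (1 + length S) * 2          ≤⟨ *-monoˡ-≤ 2 short ⟩
      n / 2 * 2                   ≤⟨ m/n*n≤m n 2 ⟩
      n                           ∎
      where open ≤-Reasoning

    short⇒¬isolating : length S ℕ.< n / 2 → ⊥
    short⇒¬isolating short
      with x , x∉L ← pigeonhole-∉ Fin._≟_ id id L (≤-trans (n≤1+n _) (room short))
      with y , y∉x∷L ← pigeonhole-∉ Fin._≟_ id id (x ∷ L) (room short)
      = untouched-edge⇒¬isolating (K n) S (K-edge x y x≢y) untouched isolating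
      where
      x≢y : x ≢ y
      x≢y = y∉x∷L ∘ here ∘ sym
      untouched : ∀ w → Incident (K n) w (K-edge x y x≢y) → ¬ Touched (K n) S w
      untouched w w∈e with K-edge-incident⁻ x y x≢y w∈e
      ... | inj₁ refl = x∉L ∘ Touched⇒∈-ends (K n)
      ... | inj₂ refl = y∉x∷L ∘ there ∘ Touched⇒∈-ends (K n)

  -- Vertex 2k + b of the first n / 2 * 2 vertices, as combine k b : Fin (n / 2 * 2).
  slot : Fin (n / 2) → Fin 2 → Fin n
  slot k b = inject≤ (combine k b) (m/n*n≤m n 2)

  slot-injective : ∀ {k k′ b b′} → slot k b ≡ slot k′ b′ → k ≡ k′ × b ≡ b′
  slot-injective {k} {k′} {b} {b′} = combine-injective k b k′ b′ ∘ inject≤-injective _ _ (combine k b) (combine k′ b′)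

  slot-surjective : (v : Fin n) → toℕ v ℕ.< n / 2 * 2 → ∃₂ λ k b → v ≡ slot k b
  slot-surjective v v<2h = k , b , toℕ-injective (begin
      toℕ v             ≡⟨ toℕ-fromℕ< v<2h ⟨
      toℕ v′            ≡⟨ cong toℕ (combine-remQuot {n / 2} 2 v′) ⟨
      toℕ (combine k b) ≡⟨ toℕ-inject≤ (combine k b) _ ⟨
      toℕ (slot k b)    ∎)
    where
    open ≡-Reasoning
    v′ : Fin (n / 2 * 2)
    v′ = fromℕ< v<2h
    k : Fin (n / 2)
    k = proj₁ (remQuot {n / 2} 2 v′)
    b : Fin 2
    b = proj₂ (remQuot {n / 2} 2 v′)

  slot-0≢1 : ∀ k → slot k Fin.zero ≢ slot k (Fin.suc Fin.zero)
  slot-0≢1 k eq with () ← proj₂ (slot-injective eq)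

  rung : Fin (n / 2) → Edge (K n)
  rung k = K-edge (slot k Fin.zero) (slot k (Fin.suc Fin.zero)) (slot-0≢1 k)

  slot-incident-rung : ∀ k b → Incident (K n) (slot k b) (rung k)
  slot-incident-rung k Fin.zero           = K-edge-incident⁺ _ _ (slot-0≢1 k) (inj₁ refl)
  slot-incident-rung k (Fin.suc Fin.zero) = K-edge-incident⁺ _ _ (slot-0≢1 k) (inj₂ refl)

  rung-cover : (v : Fin n) → toℕ v ℕ.< n / 2 * 2 → ∃ λ k → Incident (K n) v (rung k)
  rung-cover v v<2h with k , b , refl ← slot-surjective v v<2h = k , slot-incident-rung k b

  rung-injective : Injective _≡_ _≡_ rung
  rung-injective {k} {k′} rung≡
    with K-edge-incident⁻ _ _ (slot-0≢1 k′) (subst (Incident (K n) (slot k Fin.zero)) rung≡ (slot-incident-rung k Fin.zero))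
  ... | inj₁ eq = proj₁ (slot-injective eq)
  ... | inj₂ eq = proj₁ (slot-injective eq)

  n≤1+[n/2]*2 : n ℕ.≤ 1 + n / 2 * 2
  n≤1+[n/2]*2 = begin
    n                  ≡⟨ m≡m%n+[m/n]*n n 2 ⟩
    n % 2 + n / 2 * 2  ≤⟨ +-monoˡ-≤ (n / 2 * 2) (ℕ.s≤s⁻¹ (m%n<n n 2)) ⟩
    1 + n / 2 * 2      ∎
    where open ≤-Reasoning

  lower-end<[n/2]*2 : ∀ {i j : Fin n} → i Fin.< j → toℕ i ℕ.< n / 2 * 2
  lower-end<[n/2]*2 {j = j} i<j = ℕ.s<s⁻¹ (<-≤-trans (ℕ.s<s i<j) (≤-trans (toℕ<n j) n≤1+[n/2]*2))

  matching : List (Fin n ⊎ Edge (K n))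
  matching = tabulate (inj₂ ∘ rung)

  matching-isolating : IsIsolating (Mid (K n)) matching
  matching-isolating = EndTouched⇒isolating (K n) matching λ (i , j , i<j , _) →
    let k , i∈rung = rung-cover i (lower-end<[n/2]*2 i<j) in
    i , inj₁ refl , inj₂ (rung k) , ∈-tabulate⁺ k , i∈rung

  K-isolation : IsolationNumber (Mid (K n)) (n / 2)
  K-isolation =
    (matching , Unique.tabulate⁺ (rung-injective ∘ inj₂-injective) , matching-isolating , length-tabulate _) ,
    λ S _ → K-lower S

module CompleteBipartite (n₁ n₂ : ℕ) where

  Kbip-sides : ∀ {i j} → i Fin.< j → T (Kbip n₁ n₂ i j) → toℕ i ℕ.< n₁ × n₁ ℕ.≤ toℕ j
  Kbip-sides {i} {j} i<j adj with toℕ i <? n₁ | toℕ j <? n₁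
  -- in the two omitted cases adj : T false
  ... | yes i<n₁ | no j≮n₁ = i<n₁ , ≮⇒≥ j≮n₁
  ... | no i≮n₁  | yes j<n₁ = contradiction (<-trans i<j j<n₁) i≮n₁

  Kbip-adj : ∀ {i j} → toℕ i ℕ.< n₁ → n₁ ℕ.≤ toℕ j → T (Kbip n₁ n₂ i j)
  Kbip-adj {i} {j} i<n₁ n₁≤j with toℕ i <? n₁ | toℕ j <? n₁
  ... | yes _    | no _     = tt
  ... | no i≮n₁  | _        = contradiction i<n₁ i≮n₁
  ... | yes _    | yes j<n₁ = contradiction n₁≤j (<⇒≱ j<n₁)

  Kbip-edge : ∀ {i j} → toℕ i ℕ.< n₁ → n₁ ℕ.≤ toℕ j → Edge (Kbip n₁ n₂)
  Kbip-edge {i} {j} i<n₁ n₁≤j = i , j , <-≤-trans i<n₁ n₁≤j , Kbip-adj i<n₁ n₁≤j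

  Touches⇒≡end₁ : ∀ s {w} → Touches (Kbip n₁ n₂) s w → toℕ w ℕ.< n₁ → w ≡ end₁ (Kbip n₁ n₂) s
  Touches⇒≡end₁ (inj₁ _) (inj₁ refl) _ = refl
  Touches⇒≡end₁ (inj₁ _) (inj₂ refl) _ = refl
  Touches⇒≡end₁ (inj₂ _) (inj₁ refl) _ = refl
  Touches⇒≡end₁ (inj₂ (_ , _ , i<j , adj)) (inj₂ refl) w<n₁ =
    contradiction (proj₂ (Kbip-sides i<j adj)) (<⇒≱ w<n₁)

  Touches⇒≡end₂ : ∀ s {w} → Touches (Kbip n₁ n₂) s w → n₁ ℕ.≤ toℕ w → w ≡ end₂ (Kbip n₁ n₂) s
  Touches⇒≡end₂ (inj₁ _) (inj₁ refl) _ = refl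
  Touches⇒≡end₂ (inj₁ _) (inj₂ refl) _ = refl
  Touches⇒≡end₂ (inj₂ (_ , _ , i<j , adj)) (inj₁ refl) n₁≤w =
    contradiction n₁≤w (<⇒≱ (proj₁ (Kbip-sides i<j adj)))
  Touches⇒≡end₂ (inj₂ _) (inj₂ refl) _ = refl

  ↑ˡ-first : (x : Fin n₁) → toℕ (x ↑ˡ n₂) ℕ.< n₁
  ↑ˡ-first x = subst (ℕ._< n₁) (sym (toℕ-↑ˡ x n₂)) (toℕ<n x)

  ↑ʳ-second : (y : Fin n₂) → n₁ ℕ.≤ toℕ (n₁ ↑ʳ y)
  ↑ʳ-second y = subst (n₁ ℕ.≤_) (sym (toℕ-↑ʳ n₁ y)) (m≤m+n n₁ (toℕ y))

  Kbip-lower : (S : List (Fin (n₁ + n₂) ⊎ Edge (Kbip n₁ n₂))) → IsIsolating (Mid (Kbip n₁ n₂)) S →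
               n₁ ⊓ n₂ ℕ.≤ length S
  Kbip-lower S isolating = ≮⇒≥ short⇒¬isolating
    where
    L₁ L₂ : List (Fin (n₁ + n₂))
    L₁ = map (end₁ (Kbip n₁ n₂)) S
    L₂ = map (end₂ (Kbip n₁ n₂)) S

    short⇒¬isolating : length S ℕ.< n₁ ⊓ n₂ → ⊥
    short⇒¬isolating short
      with x , x∉L₁ ← pigeonhole-∉ Fin._≟_ (_↑ˡ n₂) (↑ˡ-injective n₂ _ _) L₁
                        (subst (ℕ._< n₁) (sym (length-map _ S)) (<-≤-trans short (m⊓n≤m n₁ n₂)))
      with y , y∉L₂ ← pigeonhole-∉ Fin._≟_ (n₁ ↑ʳ_) (↑ʳ-injective n₁ _ _) L₂
                        (subst (ℕ._< n₂) (sym (length-map _ S)) (<-≤-trans short (m⊓n≤n n₁ n₂)))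
      = untouched-edge⇒¬isolating (Kbip n₁ n₂) S (Kbip-edge (↑ˡ-first x) (↑ʳ-second y)) untouched isolating
      where
      untouched : ∀ w → Incident (Kbip n₁ n₂) w (Kbip-edge (↑ˡ-first x) (↑ʳ-second y)) → ¬ Touched (Kbip n₁ n₂) S w
      untouched _ (inj₁ refl) (s , s∈S , touches) =
        x∉L₁ (subst (_∈ L₁) (sym (Touches⇒≡end₁ s touches (↑ˡ-first x))) (∈-map⁺ _ s∈S))
      untouched _ (inj₂ refl) (s , s∈S , touches) =
        y∉L₂ (subst (_∈ L₂) (sym (Touches⇒≡end₂ s touches (↑ʳ-second y))) (∈-map⁺ _ s∈S))

  first-side-cover : ∀ e → ∃ λ w → Incident (Kbip n₁ n₂) w e × w ∈ tabulate (_↑ˡ n₂)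
  first-side-cover (i , _ , i<j , adj) =
    i , inj₁ refl , subst (_∈ _) (splitAt⁻¹-↑ˡ (splitAt-< n₁ i (proj₁ (Kbip-sides i<j adj)))) (∈-tabulate⁺ _)

  second-side-cover : ∀ e → ∃ λ w → Incident (Kbip n₁ n₂) w e × w ∈ tabulate (n₁ ↑ʳ_)
  second-side-cover (_ , j , i<j , adj) =
    j , inj₂ refl , subst (_∈ _) (splitAt⁻¹-↑ʳ (splitAt-≥ n₁ j (proj₂ (Kbip-sides i<j adj)))) (∈-tabulate⁺ _)

  vertex-cover-isolation : ∀ {m} (f : Fin m → Fin (n₁ + n₂)) → Injective _≡_ _≡_ f →
                           (∀ e → ∃ λ w → Incident (Kbip n₁ n₂) w e × w ∈ tabulate f) → m ≡ n₁ ⊓ n₂ →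
                           IsolationNumber (Mid (Kbip n₁ n₂)) (n₁ ⊓ n₂)
  vertex-cover-isolation f f-injective cover m≡n₁⊓n₂ =
    ( map inj₁ (tabulate f)
    , Unique.map⁺ inj₁-injective (Unique.tabulate⁺ f-injective)
    , vertex-cover⇒isolating (Kbip n₁ n₂) (tabulate f) cover
    , trans (length-map inj₁ (tabulate f)) (trans (length-tabulate f) m≡n₁⊓n₂)) ,
    λ S _ → Kbip-lower S

  Kbip-isolation : IsolationNumber (Mid (Kbip n₁ n₂)) (n₁ ⊓ n₂)
  Kbip-isolation with ≤-total n₁ n₂
  ... | inj₁ n₁≤n₂ = vertex-cover-isolation (_↑ˡ n₂) (↑ˡ-injective n₂ _ _) first-side-cover (sym (m≤n⇒m⊓n≡m n₁≤n₂))
  ... | inj₂ n₂≤n₁ = vertex-cover-isolation (n₁ ↑ʳ_) (↑ʳ-injective n₁ _ _) second-side-cover (sym (m≥n⇒m⊓n≡n n₂≤n₁))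

lemma4 : ((n : ℕ) → n ≥ 1 → IsolationNumber (Mid (K n)) (n / 2))
    × ((n₁ n₂ : ℕ) → n₁ ≥ 1 → n₂ ≥ 1 → IsolationNumber (Mid (Kbip n₁ n₂)) (n₁ ⊓ n₂))
lemma4 = (λ n _ → Complete.K-isolation n) , (λ n₁ n₂ _ _ → CompleteBipartite.Kbip-isolation n₁ n₂)
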